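{- In any multi-flock chicken graph (with at least one chicken), there exists a 1-Duke, or there exist at least three distinct 2-Dukes, or there exist at least four distinct 3-Dukes.
   Context: A multi-flock chicken graph is a finite orientation of a complete multipartite graph; vertices are called chickens and partite sets are called flocks. "$c$ pecks $d$" means the edge between $c$ and $d$ is oriented from $c$ to $d$. A peck chain of length $m$ is a directed path with $m$ edges. A chicken $d$ is an $m$-Duke if every chicken not in the flock of $d$ can be reached from $d$ by a peck chain of length at most $m$. -}

module Defs where

open import Data.Nat using (ℕ; zero; suc)
open import Data.Fin using (Fin)
open import Data.Product using (_×_; ∃-syntax)
open import Data.Sum using (_⊎_)
open import Relation.Binary.PropositionalEquality using (_≡_; _≢_)
open import Relation.Nullary using (¬_; Dec)

-- A multi-flock chicken graph on n chickens (the chickens are Fin n).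
-- flock c : Fin k says which flock (partite set) chicken c belongs to; the
-- flocks are the nonempty fibres of this map.  pecks c d means the edge between
-- c and d is oriented from c to d.
record ChickenGraph (n : ℕ) : Set₁ where
  field
    k       : ℕ
    flock   : Fin n → Fin k
    pecks   : Fin n → Fin n → Set
    pecks-diff : ∀ {c d} → pecks c d → flock c ≢ flock d
    pecks-total : ∀ c d → flock c ≢ flock d → pecks c d ⊎ pecks d c
    pecks-asym : ∀ {c d} → pecks c d → ¬ pecks d c
    -- a finite graph: adjacency is decidable (harmless, needed constructively)
    pecks? : ∀ c d → Dec (pecks c d)

module _ {n : ℕ} (G : ChickenGraph n) where
  open ChickenGraph G

  data PeckChain : ℕ → Fin n → Fin n → Set where
    stop : ∀ {c} → PeckChain zero c c
    step : ∀ {m c x d} → pecks c x → PeckChain m x d → PeckChain (suc m) c d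

  data ReachWithin : ℕ → Fin n → Fin n → Set where
    here  : ∀ {m c d} → PeckChain m c d → ReachWithin m c d
    later : ∀ {m c d} → ReachWithin m c d → ReachWithin (suc m) c d

  IsDuke : ℕ → Fin n → Set
  IsDuke m d = ∀ c → flock c ≢ flock d → ReachWithin m d c

-- If no chicken is a 1-Duke, every chicken is pecked.  The basic observation is
-- that a chicken x outside the flock of u which u cannot reach within three
-- pecks must peck u and every chicken outside its own flock that u reaches
-- within two pecks; so the 2-step ball around x strictly contains the one
-- around u.  Climbing from an in-neighbour u of t along such chickens x either
-- ends in a 3-Duke pecking t, or meets a chicken of t's flock that pecks all
-- out-neighbours of t and has strictly fewer in-neighbours.  Hence every
-- chicken is pecked by a 3-Duke.  Going backwards four times along 3-Dukes
-- gives either four distinct 3-Dukes or a 3-cycle a → b → c → a of 3-Dukes.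
-- On such a cycle either a is a 2-Duke, or climbing from a chicken that a
-- cannot reach within two pecks produces a fourth 3-Duke; if this happens at
-- no vertex, a, b and c are three 2-Dukes.
module Submission where

open import Defs
open import Data.Nat using (ℕ; zero; suc; _+_; _∸_; _<_)
open import Data.Nat.Induction using (<-wellFounded)
open import Data.Nat.Properties using (∸-monoʳ-<)
open import Data.Fin using (Fin; zero) renaming (_≟_ to _≟ᶠ_)
open import Data.Fin.Properties using (any?; all?; ¬∀⟶∃¬)
open import Data.Fin.Subset using (Subset; _∈_; _⊂_; ∣_∣)
open import Data.Fin.Subset.Properties using (p⊂q⇒∣p∣<∣q∣; ∣p∣≤n)
open import Data.Vec using (tabulate)
open import Data.Vec.Properties using (lookup⇒[]=; []=⇒lookup; lookup∘tabulate)
open import Data.Product using (_×_; ∃-syntax; _,_)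
open import Data.Sum using (_⊎_; inj₁; inj₂; [_,_]′)
open import Data.Empty using (⊥-elim)
open import Function using (_∘_; id)
open import Induction.WellFounded using (Acc; acc)
open import Relation.Binary.PropositionalEquality using (_≡_; _≢_; refl; sym; trans; subst)
open import Relation.Nullary using (¬_; Dec; yes; no; does; proof; Reflects; invert)
open import Relation.Nullary.Decidable using (map′; dec-true; _⊎-dec_; _×-dec_; _→-dec_; ¬?)
open import Relation.Unary using (Pred; Decidable; _⊆_)

module _ {n ℓ} {P : Pred (Fin n) ℓ} (P? : Decidable P) where

  toSubset : Subset n
  toSubset = tabulate (does ∘ P?)

  ∈-toSubset⁺ : ∀ {i} → P i → i ∈ toSubset
  ∈-toSubset⁺ {i} Pi = lookup⇒[]= i toSubset (trans (lookup∘tabulate _ i) (dec-true (P? i) Pi))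

  ∈-toSubset⁻ : ∀ {i} → i ∈ toSubset → P i
  ∈-toSubset⁻ {i} i∈ =
    invert (subst (Reflects (P i)) (trans (sym (lookup∘tabulate _ i)) ([]=⇒lookup i∈)) (proof (P? i)))

∣toSubset∣-< : ∀ {n ℓ} {P Q : Pred (Fin n) ℓ} (P? : Decidable P) (Q? : Decidable Q) {i} →
               P ⊆ Q → Q i → ¬ P i → ∣ toSubset P? ∣ < ∣ toSubset Q? ∣
∣toSubset∣-< P? Q? {i} P⊆Q Qi ¬Pi = p⊂q⇒∣p∣<∣q∣ P⊂Q
  where
  P⊂Q : toSubset P? ⊂ toSubset Q?
  P⊂Q = (∈-toSubset⁺ Q? ∘ P⊆Q ∘ ∈-toSubset⁻ P?) , i , ∈-toSubset⁺ Q? Qi , ¬Pi ∘ ∈-toSubset⁻ P?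

module _ {n : ℕ} (G : ChickenGraph n) where
  open ChickenGraph G

  pecks⇒≢ : ∀ {a b} → pecks a b → a ≢ b
  pecks⇒≢ ab refl = pecks-diff ab refl

  pecks-pecks⇒≢ : ∀ {a b c} → pecks a b → pecks b c → a ≢ c
  pecks-pecks⇒≢ ab bc refl = pecks-asym ab bc

  peckChain? : ∀ m c d → Dec (PeckChain G m c d)
  peckChain? zero c d = map′ (λ { refl → stop }) (λ { stop → refl }) (c ≟ᶠ d)
  peckChain? (suc m) c d =
    map′ (λ (_ , cx , xd) → step cx xd) (λ { (step cx xd) → _ , cx , xd })
         (any? λ x → pecks? c x ×-dec peckChain? m x d)

  reachWithin? : ∀ m c d → Dec (ReachWithin G m c d)
  reachWithin? zero c d = map′ here (λ { (here p) → p }) (peckChain? zero c d)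
  reachWithin? (suc m) c d =
    map′ [ here , later ]′ (λ { (here p) → inj₁ p ; (later r) → inj₂ r })
         (peckChain? (suc m) c d ⊎-dec reachWithin? m c d)

  isDuke? : ∀ m d → Dec (IsDuke G m d)
  isDuke? m d = all? λ c → ¬? (flock c ≟ᶠ flock d) →-dec reachWithin? m d c

  ¬isDuke⇒unreachable : ∀ {m d} → ¬ IsDuke G m d →
                        ∃[ c ] (flock c ≢ flock d × ¬ ReachWithin G m d c)
  ¬isDuke⇒unreachable {m} {d} ¬D
    with c , ¬reach ← ¬∀⟶∃¬ n _ (λ c → ¬? (flock c ≟ᶠ flock d) →-dec reachWithin? m d c) ¬D =
    c , (λ c∼d → ¬reach (λ c≁d → ⊥-elim (c≁d c∼d))) , (λ r → ¬reach (λ _ → r))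

  within : ∀ k {m c d} → PeckChain G m c d → ReachWithin G (k + m) c d
  within zero    p = here p
  within (suc k) p = later (within k p)

  chain-snoc : ∀ {m c d e} → PeckChain G m c d → pecks d e → PeckChain G (suc m) c e
  chain-snoc stop       de = step de stop
  chain-snoc (step p q) de = step p (chain-snoc q de)

  chain-unsnoc : ∀ {m c e} → PeckChain G (suc m) c e → ∃[ d ] (PeckChain G m c d × pecks d e)
  chain-unsnoc (step ce stop)         = _ , stop , ce
  chain-unsnoc (step cx q@(step _ _)) = let d , p , de = chain-unsnoc q in d , step cx p , de

  within-snoc : ∀ {m c d e} → ReachWithin G m c d → pecks d e → ReachWithin G (suc m) c e
  within-snoc (here p)  de = here (chain-snoc p de)
  within-snoc (later r) de = later (within-snoc r de)

  within-unsnoc : ∀ {m c e} → c ≢ e → ReachWithin G (suc m) c e →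
                  ∃[ d ] (ReachWithin G m c d × pecks d e)
  within-unsnoc c≢e (here p) = let d , q , de = chain-unsnoc p in d , here q , de
  within-unsnoc {zero}  c≢e (later (here stop)) = ⊥-elim (c≢e refl)
  within-unsnoc {suc m} c≢e (later r) = let d , q , de = within-unsnoc c≢e r in d , later q , de

  unreachable⇒pecks : ∀ {m u v x} → flock x ≢ flock v → ¬ ReachWithin G (suc m) u x →
                      ReachWithin G m u v → pecks x v
  unreachable⇒pecks {v = v} {x} x≁v u↛x uv with pecks-total x v x≁v
  ... | inj₁ xv = xv
  ... | inj₂ vx = ⊥-elim (u↛x (within-snoc uv vx))

  ball₂-size : Fin n → ℕ
  ball₂-size u = ∣ toSubset (reachWithin? 2 u) ∣

  unreachable⇒ball₂-⊆ : ∀ {u x} → flock x ≢ flock u → ¬ ReachWithin G 3 u x →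
                        ReachWithin G 2 u ⊆ ReachWithin G 2 x
  unreachable⇒ball₂-⊆ {u} {x} x≁u u↛x {v} uv with flock x ≟ᶠ flock v
  ... | no x≁v = within 1 (step (unreachable⇒pecks x≁v u↛x uv) stop)
  ... | yes x∼v with w , uw , wv ← within-unsnoc (λ { refl → x≁u x∼v }) uv =
    within 0 (step (unreachable⇒pecks x≁w (u↛x ∘ later) uw) (step wv stop))
    where
    x≁w : flock x ≢ flock w
    x≁w x∼w = pecks-diff wv (trans (sym x∼w) x∼v)

  unreachable⇒ball₂-size-< : ∀ {u x} → flock x ≢ flock u → ¬ ReachWithin G 3 u x →
                             ball₂-size u < ball₂-size x
  unreachable⇒ball₂-size-< x≁u u↛x =
    ∣toSubset∣-< (reachWithin? 2 _) (reachWithin? 2 _)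
                 (unreachable⇒ball₂-⊆ x≁u u↛x) (within 2 stop) (u↛x ∘ later)

  indegree : Fin n → ℕ
  indegree t = ∣ toSubset (λ w → pecks? w t) ∣

  Shadows : Fin n → Fin n → Set
  Shadows x t = flock x ≡ flock t × pecks t ⊆ pecks x × ∃[ w ] (pecks w t × pecks x w)

  shadow-pecked : ∀ {x t e} → Shadows x t → pecks e x → pecks e t
  shadow-pecked (x∼t , t⊆x , _) ex with pecks-total _ _ (λ e∼t → pecks-diff ex (trans e∼t (sym x∼t)))
  ... | inj₁ et = et
  ... | inj₂ te = ⊥-elim (pecks-asym ex (t⊆x te))

  shadow-indegree-< : ∀ {x t} → Shadows x t → indegree x < indegree t
  shadow-indegree-< x⊳t@(_ , _ , w , wt , xw) =
    ∣toSubset∣-< (λ e → pecks? e _) (λ e → pecks? e _) (shadow-pecked x⊳t) wt (pecks-asym xw)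

  reroot-chain : ∀ {m t x c} → pecks t ⊆ pecks x → t ≢ c → PeckChain G m t c → PeckChain G m x c
  reroot-chain t⊆x t≢c stop        = ⊥-elim (t≢c refl)
  reroot-chain t⊆x t≢c (step ty q) = step (t⊆x ty) q

  reroot-within : ∀ {m t x c} → pecks t ⊆ pecks x → t ≢ c →
                  ReachWithin G m t c → ReachWithin G m x c
  reroot-within t⊆x t≢c (here p)  = here (reroot-chain t⊆x t≢c p)
  reroot-within t⊆x t≢c (later r) = later (reroot-within t⊆x t≢c r)

  shadow-isDuke : ∀ {m x t} → Shadows x t → IsDuke G m t → IsDuke G m x
  shadow-isDuke (x∼t , t⊆x , _) Dt c c≁x =
    reroot-within t⊆x (λ { refl → c≁t refl }) (Dt c c≁t)
    where
    c≁t = λ c∼t → c≁x (trans c∼t (sym x∼t))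

  DukeAbove : Fin n → Fin n → Set
  DukeAbove t u = ∃[ e ] (pecks e t × IsDuke G 3 e × ReachWithin G 2 u ⊆ ReachWithin G 2 e)

  -- Well-founded since the 2-step ball strictly grows and has at most n elements.
  ascend-acc : ∀ {t u} → Acc _<_ (n ∸ ball₂-size u) → pecks u t → DukeAbove t u ⊎ ∃[ x ] Shadows x t
  ascend-acc {t} {u} (acc rec) ut with isDuke? 3 u
  ... | yes Du = inj₁ (u , ut , Du , id)
  ... | no ¬Du with x , x≁u , u↛x ← ¬isDuke⇒unreachable ¬Du | flock x ≟ᶠ flock t
  ... | yes x∼t = inj₂ (x , x∼t , t⊆x , u , ut , unreachable⇒pecks x≁u u↛x (within 2 stop))
    where
    t⊆x : pecks t ⊆ pecks x
    t⊆x tv = unreachable⇒pecks (λ x∼v → pecks-diff tv (trans (sym x∼t) x∼v)) u↛x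
                               (within 0 (step ut (step tv stop)))
  ... | no x≁t with ascend-acc (rec bigger-ball) xt
    where
    xt = unreachable⇒pecks x≁t u↛x (within 1 (step ut stop))
    bigger-ball = ∸-monoʳ-< (unreachable⇒ball₂-size-< x≁u u↛x)
                            (∣p∣≤n (toSubset (reachWithin? 2 x)))
  ... | inj₁ (e , et , De , x⊆e) = inj₁ (e , et , De , x⊆e ∘ unreachable⇒ball₂-⊆ x≁u u↛x)
  ... | inj₂ shadow = inj₂ shadow

  ascend : ∀ {t u} → pecks u t → DukeAbove t u ⊎ ∃[ x ] Shadows x t
  ascend = ascend-acc (<-wellFounded _)

  pecked⇒pecked-by-3-Duke : (∀ t → ∃[ u ] pecks u t) → ∀ t → ∃[ e ] (pecks e t × IsDuke G 3 e)
  pecked⇒pecked-by-3-Duke pecked t = go (<-wellFounded (indegree t))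
    where
    go : ∀ {t} → Acc _<_ (indegree t) → ∃[ e ] (pecks e t × IsDuke G 3 e)
    go {t} (acc rec) with u , ut ← pecked t | ascend ut
    ... | inj₁ (e , et , De , _) = e , et , De
    ... | inj₂ (x , x⊳t) = let e , ex , De = go (rec (shadow-indegree-< x⊳t)) in
                           e , shadow-pecked x⊳t ex , De

  FourthDuke : Fin n → Fin n → Fin n → Set
  FourthDuke a b c = ∃[ d ] (IsDuke G 3 d × d ≢ a × d ≢ b × d ≢ c)

  rotate-fourth : ∀ {a b c} → FourthDuke a b c → FourthDuke b c a
  rotate-fourth (d , Dd , d≢a , d≢b , d≢c) = d , Dd , d≢b , d≢c , d≢a

  -- A 3-Duke dominating x reaches y within two pecks, so it is not a.
  fourth-via-pecker : ∀ {a b c x y} → pecks a b → pecks b c → IsDuke G 3 b →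
                      ¬ ReachWithin G 2 a y → pecks x b → ReachWithin G 2 x y → FourthDuke a b c
  fourth-via-pecker ab bc Db a↛y xb xy with ascend xb
  ... | inj₁ (e , eb , De , x⊆e) =
    e , De , (λ { refl → a↛y (x⊆e xy) }) , pecks⇒≢ eb , pecks-pecks⇒≢ eb bc
  ... | inj₂ (x′ , x⊳b@(x∼b , _ , w , wb , xw)) =
    x′ , shadow-isDuke x⊳b Db , (λ { refl → pecks-diff ab x∼b }) , pecks-pecks⇒≢ xw wb
       , (λ { refl → pecks-diff bc (sym x∼b) })

  2-Duke-or-fourth : ∀ {a b c} → pecks a b → pecks b c → IsDuke G 3 b →
                     IsDuke G 2 a ⊎ FourthDuke a b c
  2-Duke-or-fourth {a} {b} {c} ab bc Db with isDuke? 2 a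
  ... | yes Da = inj₁ Da
  ... | no ¬Da with y , y≁a , a↛y ← ¬isDuke⇒unreachable ¬Da = inj₂ fourth
    where
    fourth : FourthDuke a b c
    fourth with flock y ≟ᶠ flock b
    ... | no y≁b = fourth-via-pecker ab bc Db a↛y
                     (unreachable⇒pecks y≁b a↛y (within 0 (step ab stop))) (within 2 stop)
    ... | yes y∼b with isDuke? 3 y
    ...   | yes Dy = y , Dy , (λ { refl → y≁a refl }) , (λ { refl → a↛y (within 1 (step ab stop)) })
                       , (λ { refl → pecks-diff bc (sym y∼b) })
    ...   | no ¬Dy with x , x≁y , y↛x ← ¬isDuke⇒unreachable ¬Dy =
      fourth-via-pecker ab bc Db a↛y
        (unreachable⇒pecks (λ x∼b → x≁y (trans x∼b (sym y∼b))) y↛x (within 0 (step ya (step ab stop))))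
        (within 1 (step (unreachable⇒pecks x≁y y↛x (within 2 stop)) stop))
      where
      ya = unreachable⇒pecks y≁a a↛y (within 1 stop)

  ThreeDukes : ℕ → Set
  ThreeDukes m = ∃[ a ] ∃[ b ] ∃[ c ] (a ≢ b × a ≢ c × b ≢ c
                 × IsDuke G m a × IsDuke G m b × IsDuke G m c)

  FourDukes : ℕ → Set
  FourDukes m = ∃[ a ] ∃[ b ] ∃[ c ] ∃[ d ] (a ≢ b × a ≢ c × a ≢ d × b ≢ c × b ≢ d × c ≢ d
                × IsDuke G m a × IsDuke G m b × IsDuke G m c × IsDuke G m d)

  add-fourth : ∀ {a b c} → a ≢ b → a ≢ c → b ≢ c →
               IsDuke G 3 a → IsDuke G 3 b → IsDuke G 3 c → FourthDuke a b c → FourDukes 3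
  add-fourth a≢b a≢c b≢c Da Db Dc (d , Dd , d≢a , d≢b , d≢c) =
    _ , _ , _ , d , a≢b , a≢c , (d≢a ∘ sym) , b≢c , (d≢b ∘ sym) , (d≢c ∘ sym) , Da , Db , Dc , Dd

  3-cycle-of-3-Dukes : ∀ {a b c} → pecks a b → pecks b c → pecks c a →
                       IsDuke G 3 a → IsDuke G 3 b → IsDuke G 3 c → ThreeDukes 2 ⊎ FourDukes 3
  3-cycle-of-3-Dukes {a} {b} {c} ab bc ca Da Db Dc =
    combine (2-Duke-or-fourth ab bc Db) (2-Duke-or-fourth bc ca Dc) (2-Duke-or-fourth ca ab Da)
    where
    four : FourthDuke a b c → FourDukes 3
    four = add-fourth (pecks⇒≢ ab) (pecks⇒≢ ca ∘ sym) (pecks⇒≢ bc) Da Db Dc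

    combine : IsDuke G 2 a ⊎ FourthDuke a b c → IsDuke G 2 b ⊎ FourthDuke b c a →
              IsDuke G 2 c ⊎ FourthDuke c a b → ThreeDukes 2 ⊎ FourDukes 3
    combine (inj₂ d) _        _        = inj₂ (four d)
    combine (inj₁ _) (inj₂ d) _        = inj₂ (four (rotate-fourth (rotate-fourth d)))
    combine (inj₁ _) (inj₁ _) (inj₂ d) = inj₂ (four (rotate-fourth d))
    combine (inj₁ D₂a) (inj₁ D₂b) (inj₁ D₂c) =
      inj₁ (a , b , c , pecks⇒≢ ab , (pecks⇒≢ ca ∘ sym) , pecks⇒≢ bc , D₂a , D₂b , D₂c)

  ¬1-Duke⇒pecked : ¬ (∃[ d ] IsDuke G 1 d) → ∀ t → ∃[ u ] pecks u t
  ¬1-Duke⇒pecked ¬D t with u , u≁t , t↛u ← ¬isDuke⇒unreachable (λ Dt → ¬D (t , Dt)) =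
    u , unreachable⇒pecks u≁t t↛u (within 0 stop)

  pecked-by-3-Dukes⇒Dukes : (∀ t → ∃[ e ] (pecks e t × IsDuke G 3 e)) →
                            Fin n → ThreeDukes 2 ⊎ FourDukes 3
  pecked-by-3-Dukes⇒Dukes pecked-by-3-Duke t with pecked-by-3-Duke t
  ... | e₁ , _   , D₁ with pecked-by-3-Duke e₁
  ... | e₂ , p₂₁ , D₂ with pecked-by-3-Duke e₂
  ... | e₃ , p₃₂ , D₃ with pecked-by-3-Duke e₃
  ... | e₄ , p₄₃ , D₄ with e₄ ≟ᶠ e₁
  ... | yes refl = 3-cycle-of-3-Dukes p₄₃ p₃₂ p₂₁ D₄ D₃ D₂
  ... | no e₄≢e₁ =
    inj₂ (add-fourth (pecks⇒≢ p₂₁ ∘ sym) (pecks-pecks⇒≢ p₃₂ p₂₁ ∘ sym) (pecks⇒≢ p₃₂ ∘ sym) D₁ D₂ D₃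
                     (e₄ , D₄ , e₄≢e₁ , pecks-pecks⇒≢ p₄₃ p₃₂ , pecks⇒≢ p₄₃))

theorem5 : (n : ℕ) (G : ChickenGraph (suc n)) →
    (∃[ d ] IsDuke G 1 d)
    ⊎ (∃[ a ] ∃[ b ] ∃[ c ] (a ≢ b × a ≢ c × b ≢ c
         × IsDuke G 2 a × IsDuke G 2 b × IsDuke G 2 c))
    ⊎ (∃[ a ] ∃[ b ] ∃[ c ] ∃[ d ] (a ≢ b × a ≢ c × a ≢ d × b ≢ c × b ≢ d × c ≢ d
         × IsDuke G 3 a × IsDuke G 3 b × IsDuke G 3 c × IsDuke G 3 d))
theorem5 n G with any? (isDuke? G 1)
... | yes D  = inj₁ D
... | no ¬D = inj₂ (pecked-by-3-Dukes⇒Dukes G pecked-by-3-Duke zero)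
  where
  pecked-by-3-Duke = pecked⇒pecked-by-3-Duke G (¬1-Duke⇒pecked G ¬D)
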